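{- Let $\Gamma$ be an infinite torsion-free Abelian group and let $T$ be a tree of diameter $4$ with central vertex $v_c$. Then $T$ is $\Gamma$-vertex magic if and only if $T$ satisfies one of the following: (i) every non-pendant vertex of $T$ is in $\Omega_{\mathfrak{s}}(T)$; (ii) $v_c\in \Omega_{\mathfrak{w}}(T)$ and all other non-pendant vertices of $T$ are in $\Omega_{\mathfrak{s}}(T)$.
   Context: Graphs are finite, simple and undirected. For an additive Abelian group $\Gamma$ with identity $0$ and a graph $G$, a $\Gamma$-vertex magic labeling is a map $\ell:V(G)\to\Gamma\setminus\{0\}$ for which there is $\mu\in\Gamma$ (the magic constant) with $w(v)=\sum_{u\in N(v)}\ell(u)=\mu$ for every vertex $v$; $G$ is $\Gamma$-vertex magic if it has such a labeling. A pendant vertex has degree $1$; a support vertex is a vertex adjacent to a pendant vertex. $\Omega_{\mathfrak{s}}(T)$ is the set of strong support vertices (adjacent to at least two pendant vertices), $\Omega_{\mathfrak{w}}(T)$ the set of weak support vertices (adjacent to exactly one pendant vertex). A tree of diameter $4$ has a unique central vertex $v_c$. An Abelian group is torsion-free if $0$ is its only element of finite order. -}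

module Defs where

open import Level using (Level; _⊔_)
open import Data.Nat using (ℕ; zero; suc; _+_; _≤_)
open import Data.Bool using (Bool; true; false; if_then_else_; _∧_)
open import Data.Fin using (Fin; zero; suc; inject₁; fromℕ)
open import Data.Product using (Σ; ∃; ∃-syntax; _×_; _,_)
open import Data.Sum using (_⊎_)
open import Relation.Nullary using (¬_)
open import Relation.Binary.PropositionalEquality using (_≡_; _≢_)
open import Function.Definitions using (Injective)
open import Algebra.Bundles using (AbelianGroup)

record Graph (n : ℕ) : Set where
  field
    adj     : Fin n → Fin n → Bool
    adj-sym : ∀ u v → adj u v ≡ adj v u
    irrefl  : ∀ v → adj v v ≡ false
open Graph public

countFin : ∀ {n} → (Fin n → Bool) → ℕ
countFin {zero}  p = 0
countFin {suc n} p = (if p zero then 1 else 0) + countFin (λ i → p (suc i))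

module _ {n : ℕ} (G : Graph n) where

  degree : Fin n → ℕ
  degree v = countFin (adj G v)

  Pendant : Fin n → Set
  Pendant v = degree v ≡ 1

  isPendant : Fin n → Bool
  isPendant v = Data.Nat._≡ᵇ_ (degree v) 1

  pendantNbrs : Fin n → ℕ
  pendantNbrs v = countFin (λ u → adj G v u ∧ isPendant u)

  StrongSupport : Fin n → Set
  StrongSupport v = 2 ≤ pendantNbrs v

  WeakSupport : Fin n → Set
  WeakSupport v = pendantNbrs v ≡ 1

  data Walk : Fin n → Fin n → ℕ → Set where
    nil  : ∀ {u} → Walk u u 0
    cons : ∀ {u w v k} → adj G u w ≡ true → Walk w v k → Walk u v (suc k)

  Connected : Set
  Connected = ∀ u v → ∃[ k ] Walk u v k

  record Cycle : Set where
    field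
      m      : ℕ
      vtx    : Fin (suc (suc (suc m))) → Fin n
      inj    : Injective _≡_ _≡_ vtx
      step   : ∀ (i : Fin (suc (suc m))) → adj G (vtx (inject₁ i)) (vtx (suc i)) ≡ true
      close  : adj G (vtx (fromℕ (suc (suc m)))) (vtx zero) ≡ true

  Acyclic : Set
  Acyclic = ¬ Cycle

  IsTree : Set
  IsTree = Connected × Acyclic

  Dist : Fin n → Fin n → ℕ → Set
  Dist u v d = Walk u v d × (∀ k → Walk u v k → d ≤ k)

  Diameter : ℕ → Set
  Diameter d = (∀ u v → ∃[ k ] (k ≤ d × Walk u v k)) × (∃[ u ] ∃[ v ] Dist u v d)

  EccAtMost : Fin n → ℕ → Set
  EccAtMost v k = ∀ u → ∃[ j ] (j ≤ k × Walk v u j)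

  IsCentral : Fin n → Set
  IsCentral v = ∀ w k → EccAtMost w k → EccAtMost v k

module _ {c ℓ : Level} (Γ : AbelianGroup c ℓ) where
  open AbelianGroup Γ

  times : ℕ → Carrier → Carrier
  times zero    x = ε
  times (suc k) x = x ∙ times k x

  sumFin : ∀ {n} → (Fin n → Carrier) → Carrier
  sumFin {zero}  f = ε
  sumFin {suc n} f = f zero ∙ sumFin (λ i → f (suc i))

  TorsionFree : Set (c ⊔ ℓ)
  TorsionFree = ∀ (x : Carrier) (k : ℕ) → times (suc k) x ≈ ε → x ≈ ε

  Infinite : Set (c ⊔ ℓ)
  Infinite = ∀ (k : ℕ) (f : Fin k → Carrier) → ∃[ x ] (∀ i → ¬ (x ≈ f i))

  module _ {n : ℕ} (G : Graph n) where
    weight : (Fin n → Carrier) → Fin n → Carrier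
    weight lab v = sumFin (λ u → if adj G v u then lab u else ε)

    IsVertexMagicLabeling : (Fin n → Carrier) → Set (c ⊔ ℓ)
    IsVertexMagicLabeling lab =
      (∀ v → ¬ (lab v ≈ ε)) × (∃[ μ ] (∀ v → weight lab v ≈ μ))

    VertexMagic : Set (c ⊔ ℓ)
    VertexMagic = ∃[ lab ] IsVertexMagicLabeling lab

{-# OPTIONS --safe #-}
module Submission where

-- Necessity. If λ is magic with constant μ, a leaf has weight equal to the label of its
-- neighbour, so every support vertex is labelled μ. In a tree of diameter 4 every vertex
-- other than v_c and its neighbours is a leaf, so a non-pendant v ≠ v_c is a support vertex
-- adjacent to v_c whose other neighbours are leaves. If v_c supports no leaf, all its
-- neighbours are labelled μ and w(v_c) = deg(v_c)·μ = μ with deg(v_c) ≥ 2, so μ = 0 by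
-- torsion-freeness. Hence v_c is a support vertex labelled μ, and then w(v) = μ forces the
-- leaves at v to have labels summing to 0, impossible if there is only one.
--
-- Sufficiency. Fix g ≠ 0, label every vertex g except one chosen leaf at each support
-- vertex s, which gets g − (deg(s) − 1)·g; all weights are then g, and the exceptional
-- labels are nonzero because deg(s) ≥ 3.
--
-- The tree facts (v_c has eccentricity 2, and so on) rest on one property of acyclic
-- graphs: all backtrack-free walks between two vertices have the same length.

open import Defs
open import Level using (Level)
open import Data.Nat using (ℕ; zero; suc; pred; _+_; _≤_; z≤n; s≤s; s≤s⁻¹)
open import Data.Nat.Properties using (+-suc; ≤-trans; ≤-reflexive; n≤1+n; m≤n+m; +-mono-≤)
open import Data.Fin using (Fin; zero; suc; _≟_; inject₁; fromℕ)
open import Data.Fin.Properties using (any?)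
open import Data.List using (List; []; _∷_; _++_; length; lookup)
open import Data.List.Membership.Propositional using (_∈_; _∉_)
open import Data.List.Membership.Propositional.Properties using (∈-lookup; ∈-++⁺ˡ)
open import Data.List.Relation.Unary.Any using (here; there)
open import Data.Bool using (Bool; true; false; _∧_; not; if_then_else_)
open import Data.Bool.Properties using (∧-identityʳ)
open import Data.Sum using (_⊎_; inj₁; inj₂)
open import Data.Product using (Σ; ∃-syntax; _×_; _,_; proj₁; proj₂)
open import Data.Empty using (⊥; ⊥-elim)
open import Function using (_∘_)
open import Function.Bundles using (_⇔_; mk⇔)
open import Data.Unit using (⊤; tt)
open import Algebra.Bundles using (AbelianGroup)
open import Relation.Nullary using (¬_; Dec; yes; no; does)
open import Relation.Nullary.Decidable using (dec-true; dec-false)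
open import Relation.Binary.PropositionalEquality
  using (_≡_; _≢_; refl; sym; trans; cong; cong₂; subst; ≢-sym)

does-true : ∀ {a} {A : Set a} (d : Dec A) → does d ≡ true → A
does-true (yes a) _ = a

∧-true : ∀ a {b} → a ∧ b ≡ true → a ≡ true × b ≡ true
∧-true true b≡true = refl , b≡true

_without_ : ∀ {n} → (Fin n → Bool) → Fin n → Fin n → Bool
(p without s) u = p u ∧ not (does (u ≟ s))

without-≢ : ∀ {n} (p : Fin n → Bool) {s u} → u ≢ s → (p without s) u ≡ p u
without-≢ p {s} {u} u≢s rewrite dec-false (u ≟ s) u≢s = ∧-identityʳ (p u)

without-true : ∀ {n} (p : Fin n → Bool) {s u} → (p without s) u ≡ true → p u ≡ true × u ≢ s
without-true p {s} {u} h with u ≟ s | p u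
... | no u≢s | true  = refl , u≢s
... | yes _  | true  with () ← h
... | _      | false with () ← h

HoldsOnlyAt : ∀ {n} → (Fin n → Bool) → Fin n → Set
HoldsOnlyAt p s = ∀ u → p u ≡ true → u ≡ s

without-unique : ∀ {n} (p : Fin n → Bool) {s} → HoldsOnlyAt p s → ∀ u → (p without s) u ≡ false
without-unique p {s} uniq u with (p without s) u in h
... | false = refl
... | true  = let pu , u≢s = without-true p h in ⊥-elim (u≢s (uniq u pu))

countFin-cong : ∀ {n} {p q : Fin n → Bool} → (∀ u → p u ≡ q u) → countFin p ≡ countFin q
countFin-cong {zero}  p≗q = refl
countFin-cong {suc n} p≗q rewrite p≗q zero = cong (_ +_) (countFin-cong (λ u → p≗q (suc u)))

countFin-remove : ∀ {n} (p : Fin n → Bool) {s} → p s ≡ true → countFin p ≡ suc (countFin (p without s))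
countFin-remove p {zero} ps rewrite ps = cong suc (countFin-cong (λ u → sym (∧-identityʳ (p (suc u)))))
countFin-remove p {suc s} ps rewrite ∧-identityʳ (p zero) =
  trans (cong (c₀ +_) (countFin-remove (λ u → p (suc u)) ps)) (+-suc c₀ _)
  where c₀ = if p zero then 1 else 0

countFin-all-false : ∀ {n} (p : Fin n → Bool) → (∀ u → p u ≡ false) → countFin p ≡ 0
countFin-all-false {zero}  p p≗false = refl
countFin-all-false {suc n} p p≗false rewrite p≗false zero = countFin-all-false _ (λ u → p≗false (suc u))

countFin-zero : ∀ {n} (p : Fin n → Bool) → countFin p ≡ 0 → ∀ u → p u ≡ false
countFin-zero p #p≡0 u with p u in pu
... | false = refl
... | true with () ← trans (sym #p≡0) (countFin-remove p pu)

countFin-witness : ∀ {n} (p : Fin n → Bool) → 1 ≤ countFin p → ∃[ u ] p u ≡ true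
countFin-witness {suc n} p #p≥1 with p zero in p0
... | true  = zero , p0
... | false = let u , pu = countFin-witness (λ u → p (suc u)) #p≥1 in suc u , pu

countFin-unique : ∀ {n} (p : Fin n → Bool) {s} → p s ≡ true → HoldsOnlyAt p s → countFin p ≡ 1
countFin-unique p ps uniq = trans (countFin-remove p ps) (cong suc (countFin-all-false _ (without-unique p uniq)))

countFin-one : ∀ {n} (p : Fin n → Bool) → countFin p ≡ 1 → ∃[ s ] (p s ≡ true × HoldsOnlyAt p s)
countFin-one p #p≡1 with countFin-witness p (≤-reflexive (sym #p≡1))
... | s , ps = s , ps , uniq
  where
  rest-false : ∀ u → (p without s) u ≡ false
  rest-false = countFin-zero _ (cong pred (trans (sym (countFin-remove p ps)) #p≡1))
  uniq : HoldsOnlyAt p s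
  uniq u pu with u ≟ s
  ... | yes u≡s = u≡s
  ... | no u≢s  with () ← trans (sym (trans (without-≢ p u≢s) pu)) (rest-false u)

countFin-two : ∀ {n} (p : Fin n → Bool) {s t} → p s ≡ true → p t ≡ true → t ≢ s → 2 ≤ countFin p
countFin-two p {s} {t} ps pt t≢s rewrite countFin-remove p ps
  with countFin (p without s) in #rest
... | zero  with () ← trans (sym (trans (without-≢ p t≢s) pt)) (countFin-zero _ #rest t)
... | suc _ = s≤s (s≤s z≤n)

countFin-split : ∀ {n} (p q : Fin n → Bool) →
  countFin p ≡ countFin (λ u → p u ∧ q u) + countFin (λ u → p u ∧ not (q u))
countFin-split {zero}  p q = refl
countFin-split {suc n} p q with p zero | q zero | countFin-split (λ u → p (suc u)) (λ u → q (suc u))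
... | false | _     | ih = ih
... | true  | true  | ih = cong suc ih
... | true  | false | ih = trans (cong suc ih) (sym (+-suc _ _))

module Sums {c ℓ : Level} (Γ : AbelianGroup c ℓ) where
  open AbelianGroup Γ renaming (refl to ≈-refl; sym to ≈-sym; trans to ≈-trans)
  open import Algebra.Properties.CommutativeSemigroup commutativeSemigroup using (interchange; x∙yz≈y∙xz)
  open import Algebra.Properties.Group group using (loop)
  open import Algebra.Properties.Loop loop using (identityʳ-unique)

  sumOver : ∀ {n} → (Fin n → Bool) → (Fin n → Carrier) → Carrier
  sumOver p f = sumFin Γ (λ u → if p u then f u else ε)

  sumFin-cong : ∀ {n} {f h : Fin n → Carrier} → (∀ u → f u ≈ h u) → sumFin Γ f ≈ sumFin Γ h
  sumFin-cong {zero}  f≈h = ≈-refl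
  sumFin-cong {suc n} f≈h = ∙-cong (f≈h zero) (sumFin-cong (λ u → f≈h (suc u)))

  sumFin-∙ : ∀ {n} (f h : Fin n → Carrier) → sumFin Γ (λ u → f u ∙ h u) ≈ sumFin Γ f ∙ sumFin Γ h
  sumFin-∙ {zero}  f h = ≈-sym (identityˡ ε)
  sumFin-∙ {suc n} f h =
    ≈-trans (∙-congˡ (sumFin-∙ (λ u → f (suc u)) (λ u → h (suc u)))) (interchange _ _ _ _)

  sumOver-≗ : ∀ {n} {p q : Fin n → Bool} (f : Fin n → Carrier) → (∀ u → p u ≡ q u) →
    sumOver p f ≈ sumOver q f
  sumOver-≗ f p≗q = sumFin-cong (λ u → reflexive (cong (λ b → if b then f u else ε) (p≗q u)))

  sumOver-all-false : ∀ {n} (p : Fin n → Bool) (f : Fin n → Carrier) → (∀ u → p u ≡ false) →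
    sumOver p f ≈ ε
  sumOver-all-false {zero}  p f p≗false = ≈-refl
  sumOver-all-false {suc n} p f p≗false rewrite p≗false zero =
    ≈-trans (identityˡ _) (sumOver-all-false _ (λ u → f (suc u)) (λ u → p≗false (suc u)))

  sumOver-split : ∀ {n} (p q : Fin n → Bool) (f : Fin n → Carrier) →
    sumOver p f ≈ sumOver (λ u → p u ∧ q u) f ∙ sumOver (λ u → p u ∧ not (q u)) f
  sumOver-split p q f = ≈-trans (sumFin-cong split-at)
    (sumFin-∙ (λ u → if p u ∧ q u then f u else ε) (λ u → if p u ∧ not (q u) then f u else ε))
    where
    split-at : ∀ u → (if p u then f u else ε) ≈
      (if p u ∧ q u then f u else ε) ∙ (if p u ∧ not (q u) then f u else ε)
    split-at u with p u | q u
    ... | true  | true  = ≈-sym (identityʳ _)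
    ... | true  | false = ≈-sym (identityˡ _)
    ... | false | _     = ≈-sym (identityˡ _)

  sumOver-remove : ∀ {n} (p : Fin n → Bool) (f : Fin n → Carrier) {s} → p s ≡ true →
    sumOver p f ≈ f s ∙ sumOver (p without s) f
  sumOver-remove p f {zero} ps rewrite ps =
    ∙-congˡ (≈-trans (sumOver-≗ _ (λ u → sym (∧-identityʳ (p (suc u))))) (≈-sym (identityˡ _)))
  sumOver-remove p f {suc s} ps rewrite ∧-identityʳ (p zero) =
    ≈-trans (∙-congˡ (sumOver-remove (λ u → p (suc u)) (λ u → f (suc u)) ps)) (x∙yz≈y∙xz _ _ _)

  sumOver-unique : ∀ {n} (p : Fin n → Bool) (f : Fin n → Carrier) {s} → p s ≡ true →
    HoldsOnlyAt p s → sumOver p f ≈ f s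
  sumOver-unique p f ps uniq =
    ≈-trans (sumOver-remove p f ps)
            (≈-trans (∙-congˡ (sumOver-all-false _ f (without-unique p uniq))) (identityʳ _))

  sumOver-const : ∀ {n} (p : Fin n → Bool) (f : Fin n → Carrier) {μ} →
    (∀ u → p u ≡ true → f u ≈ μ) → sumOver p f ≈ times Γ (countFin p) μ
  sumOver-const {zero}  p f f≈μ = ≈-refl
  sumOver-const {suc n} p f f≈μ
    with p zero in p0 | sumOver-const (λ u → p (suc u)) (λ u → f (suc u)) (λ u → f≈μ (suc u))
  ... | true  | tail-sum = ∙-cong (f≈μ zero p0) tail-sum
  ... | false | tail-sum = ≈-trans (identityˡ _) tail-sum

  times-fixed⇒≈ε : TorsionFree Γ → ∀ {x k} → 2 ≤ k → times Γ k x ≈ x → x ≈ ε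
  times-fixed⇒≈ε torsionFree {x} {suc (suc k)} (s≤s (s≤s z≤n)) x+[k+1]x≈x =
    torsionFree x k (identityʳ-unique x _ x+[k+1]x≈x)

module Walks {n : ℕ} (G : Graph n) where
  open import Data.List.Membership.DecPropositional (_≟_ {n}) using (_∈?_)

  Adj : Fin n → Fin n → Set
  Adj u v = adj G u v ≡ true

  Adj-sym : ∀ {u v} → Adj u v → Adj v u
  Adj-sym {u} {v} uv = trans (adj-sym G v u) uv

  Adj-irrefl : ∀ {u} → ¬ Adj u u
  Adj-irrefl {u} uu with () ← trans (sym uu) (irrefl G u)

  NoBacktrack : ∀ {u v k} → Walk G u v k → Set
  NoBacktrack nil                                = ⊤
  NoBacktrack (cons _ nil)                       = ⊤
  NoBacktrack (cons {u = u} _ (cons {w = x} e w)) = u ≢ x × NoBacktrack (cons e w)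

  noBacktrack-tail : ∀ {u w v k} (e : Adj u w) (r : Walk G w v k) → NoBacktrack (cons e r) → NoBacktrack r
  noBacktrack-tail e nil         _        = tt
  noBacktrack-tail e (cons e′ r) (_ , nb) = nb

  removeBacktracks : ∀ {u v k} → Walk G u v k → ∃[ j ] (j ≤ k × Σ (Walk G u v j) NoBacktrack)
  removeBacktracks nil = 0 , z≤n , nil , tt
  removeBacktracks (cons {u = u} e w) with removeBacktracks w
  ... | 0 , _ , nil , _ = 1 , s≤s z≤n , cons e nil , tt
  ... | suc j , j≤k , cons {w = y} e′ r , nb with u ≟ y
  ...   | yes refl = j , ≤-trans (n≤1+n j) (≤-trans j≤k (n≤1+n _)) , r , noBacktrack-tail e′ r nb
  ...   | no u≢y   = suc (suc j) , s≤s j≤k , cons e (cons e′ r) , u≢y , nb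

  Linked : List (Fin n) → Set
  Linked []            = ⊤
  Linked (_ ∷ [])      = ⊤
  Linked (x ∷ y ∷ xs) = Adj x y × Linked (y ∷ xs)

  Distinct : List (Fin n) → Set
  Distinct []       = ⊤
  Distinct (x ∷ xs) = x ∉ xs × Distinct xs

  lastOf : Fin n → List (Fin n) → Fin n
  lastOf x []       = x
  lastOf _ (y ∷ xs) = lastOf y xs

  linked-step : ∀ x xs → Linked (x ∷ xs) → (i : Fin (length xs)) →
    Adj (lookup (x ∷ xs) (inject₁ i)) (lookup (x ∷ xs) (suc i))
  linked-step x (y ∷ xs) (xy , _)  zero    = xy
  linked-step x (y ∷ xs) (_ , lnk) (suc i) = linked-step y xs lnk i

  lookup-last : ∀ x xs → lookup (x ∷ xs) (fromℕ (length xs)) ≡ lastOf x xs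
  lookup-last x []       = refl
  lookup-last x (y ∷ xs) = lookup-last y xs

  lookup-injective : ∀ xs → Distinct xs → ∀ i j → lookup xs i ≡ lookup xs j → i ≡ j
  lookup-injective (x ∷ xs) _         zero    zero    _  = refl
  lookup-injective (x ∷ xs) (x∉ , _)  zero    (suc j) eq = ⊥-elim (x∉ (subst (_∈ xs) (sym eq) (∈-lookup j)))
  lookup-injective (x ∷ xs) (x∉ , _)  (suc i) zero    eq = ⊥-elim (x∉ (subst (_∈ xs) eq (∈-lookup i)))
  lookup-injective (x ∷ xs) (_ , dst) (suc i) (suc j) eq = cong suc (lookup-injective xs dst i j eq)

  closedPath⇒cycle : ∀ a b c xs → Distinct (a ∷ b ∷ c ∷ xs) → Linked (a ∷ b ∷ c ∷ xs) →
    Adj (lastOf c xs) a → Cycle G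
  closedPath⇒cycle a b c xs dst lnk closing = record
    { m     = length xs
    ; vtx   = lookup (a ∷ b ∷ c ∷ xs)
    ; inj   = lookup-injective (a ∷ b ∷ c ∷ xs) dst _ _
    ; step  = linked-step a (b ∷ c ∷ xs) lnk
    ; close = subst (λ z → Adj z a) (sym (lookup-last a (b ∷ c ∷ xs))) closing
    }

  distinct-++ˡ : ∀ xs ys → Distinct (xs ++ ys) → Distinct xs
  distinct-++ˡ []       ys _          = tt
  distinct-++ˡ (x ∷ xs) ys (x∉ , dst) = (λ x∈ → x∉ (∈-++⁺ˡ x∈)) , distinct-++ˡ xs ys dst

  linked-++ˡ : ∀ xs ys → Linked (xs ++ ys) → Linked xs
  linked-++ˡ []           ys _          = tt
  linked-++ˡ (x ∷ [])     ys _          = tt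
  linked-++ˡ (x ∷ y ∷ xs) ys (xy , lnk) = xy , linked-++ˡ (y ∷ xs) ys lnk

  prefixTo : ∀ {x y xs} → x ∈ (y ∷ xs) → List (Fin n)
  prefixTo (here _)               = []
  prefixTo {xs = z ∷ _} (there x∈) = z ∷ prefixTo x∈

  prefixTo-++ : ∀ {x y xs} (x∈ : x ∈ (y ∷ xs)) → ∃[ rest ] xs ≡ prefixTo x∈ ++ rest
  prefixTo-++ {xs = xs}    (here _)   = xs , refl
  prefixTo-++ {xs = z ∷ _} (there x∈) = let rest , eq = prefixTo-++ x∈ in rest , cong (z ∷_) eq

  lastOf-prefixTo : ∀ {x y xs} (x∈ : x ∈ (y ∷ xs)) → lastOf y (prefixTo x∈) ≡ x
  lastOf-prefixTo (here x≡y)               = sym x≡y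
  lastOf-prefixTo {xs = _ ∷ _} (there x∈) = lastOf-prefixTo x∈

  closingEdge⇒cycle : ∀ {x} u p y xs (x∈ : x ∈ (y ∷ xs)) →
    Distinct (u ∷ p ∷ y ∷ xs) → Linked (u ∷ p ∷ y ∷ xs) → Adj u x → Cycle G
  closingEdge⇒cycle u p y xs x∈ dst lnk ux with prefixTo-++ x∈
  ... | rest , eq =
    closedPath⇒cycle u p y (prefixTo x∈)
      (distinct-++ˡ (u ∷ p ∷ y ∷ prefixTo x∈) rest (subst (λ zs → Distinct (u ∷ p ∷ y ∷ zs)) eq dst))
      (linked-++ˡ (u ∷ p ∷ y ∷ prefixTo x∈) rest (subst (λ zs → Linked (u ∷ p ∷ y ∷ zs)) eq lnk))
      (subst (λ z → Adj z u) (sym (lastOf-prefixTo x∈)) (Adj-sym ux))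

  -- Follow a backtrack-free walk from the head u of a reversed path u p xs until it
  -- first revisits the path; it must, since it ends on the path.
  returningWalk⇒cycle : ∀ {p u v k} xs (e : Adj p u) (w : Walk G u v k) → NoBacktrack (cons e w) →
    Distinct (u ∷ p ∷ xs) → Linked (u ∷ p ∷ xs) → v ∈ (p ∷ xs) → Cycle G
  returningWalk⇒cycle xs e nil _ (u∉ , _) _ v∈ = ⊥-elim (u∉ v∈)
  returningWalk⇒cycle {p} {u} xs e (cons {w = x} e′ r) nb dst lnk v∈ with x ∈? (u ∷ p ∷ xs)
  ... | no x∉                   =
    returningWalk⇒cycle (p ∷ xs) e′ r (proj₂ nb) (x∉ , dst) (Adj-sym e′ , lnk) (there v∈)
  ... | yes (here refl)         = ⊥-elim (Adj-irrefl e′)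
  ... | yes (there (here x≡p))  = ⊥-elim (proj₁ nb (sym x≡p))
  returningWalk⇒cycle {p} {u} (y ∷ xs) e (cons e′ r) nb dst lnk v∈ | yes (there (there x∈)) =
    closingEdge⇒cycle u p y xs x∈ dst lnk e′

  closedWalk⇒cycle : ∀ {u k} (w : Walk G u u (suc k)) → NoBacktrack w → Cycle G
  closedWalk⇒cycle (cons e r) nb =
    returningWalk⇒cycle [] e r nb ((λ { (here refl) → Adj-irrefl e }) , (λ ()) , tt)
                                  (Adj-sym e , tt) (here refl)

  visits : ∀ {u v k} → Walk G u v k → List (Fin n)
  visits nil                = []
  visits (cons {w = x} _ r) = x ∷ visits r

  linked-visits : ∀ {u v k} (w : Walk G u v k) → Linked (u ∷ visits w)
  linked-visits nil                  = tt
  linked-visits (cons e nil)         = e , tt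
  linked-visits (cons e (cons e′ r)) = e , linked-visits (cons e′ r)

  end∈visits : ∀ {u v k} (w : Walk G u v k) → v ∈ (u ∷ visits w)
  end∈visits nil        = here refl
  end∈visits (cons _ r) = there (end∈visits r)

  walkTo-visited : ∀ {p u v y k} (e : Adj p u) (w : Walk G u v k) → NoBacktrack (cons e w) →
    y ∈ (u ∷ visits w) → ∃[ j ] Σ (Walk G u y j) (λ q → NoBacktrack (cons e q))
  walkTo-visited e w           nb (here refl) = 0 , nil , tt
  walkTo-visited e (cons e′ r) nb (there y∈)  =
    let j , q , nbq = walkTo-visited e′ r (noBacktrack-tail e (cons e′ r) nb) y∈
    in suc j , cons e′ q , proj₁ nb , nbq

  module Acyclic (acyclic : ¬ Cycle G) where

    noBacktrack⇒distinct : ∀ {u v k} (w : Walk G u v k) → NoBacktrack w → Distinct (u ∷ visits w)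
    noBacktrack⇒distinct nil        _  = (λ ()) , tt
    noBacktrack⇒distinct (cons e r) nb =
      (λ u∈ → let _ , q , nbq = walkTo-visited e r nb u∈ in acyclic (closedWalk⇒cycle (cons e q) nbq)) ,
      noBacktrack⇒distinct r (noBacktrack-tail e r nb)

    noBacktrack-length-unique : ∀ {a b k₁ k₂} (w₁ : Walk G a b k₁) (w₂ : Walk G a b k₂) →
      NoBacktrack w₁ → NoBacktrack w₂ → k₁ ≡ k₂
    noBacktrack-length-unique nil        nil        _   _   = refl
    noBacktrack-length-unique nil        (cons e r) _   nb₂ = ⊥-elim (acyclic (closedWalk⇒cycle _ nb₂))
    noBacktrack-length-unique (cons e r) nil        nb₁ _   = ⊥-elim (acyclic (closedWalk⇒cycle _ nb₁))
    noBacktrack-length-unique (cons {w = x₁} e₁ r₁) (cons {w = x₂} e₂ r₂) nb₁ nb₂ with x₁ ≟ x₂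
    ... | yes refl =
      cong suc (noBacktrack-length-unique r₁ r₂ (noBacktrack-tail e₁ r₁ nb₁) (noBacktrack-tail e₂ r₂ nb₂))
    ... | no x₁≢x₂ = ⊥-elim (acyclic (returningWalk⇒cycle (visits r₂) (Adj-sym e₂) (cons e₁ r₁)
                       ((λ eq → x₁≢x₂ (sym eq)) , nb₁)
                       (noBacktrack⇒distinct (cons e₂ r₂) nb₂) (linked-visits (cons e₂ r₂)) (end∈visits r₂)))

    noBacktrack-shortest : ∀ {a b j k} (w : Walk G a b j) → NoBacktrack w → Walk G a b k → j ≤ k
    noBacktrack-shortest w nb w′ with removeBacktracks w′
    ... | i , i≤k , w″ , nb″ = subst (_≤ _) (sym (noBacktrack-length-unique w w″ nb nb″)) i≤k

module Leaves {n : ℕ} (G : Graph n) where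
  open Walks G using (Adj)

  pendantNbr nonPendantNbr : Fin n → Fin n → Bool
  pendantNbr    v u = adj G v u ∧ isPendant G u
  nonPendantNbr v u = adj G v u ∧ not (isPendant G u)

  degree-split : ∀ v → degree G v ≡ pendantNbrs G v + countFin (nonPendantNbr v)
  degree-split v = countFin-split (adj G v) (isPendant G)

  Pendant⇒isPendant : ∀ {v} → Pendant G v → isPendant G v ≡ true
  Pendant⇒isPendant {v} = dec-true (degree G v Data.Nat.≟ 1)

  ¬Pendant⇒isPendant : ∀ {v} → ¬ Pendant G v → isPendant G v ≡ false
  ¬Pendant⇒isPendant {v} = dec-false (degree G v Data.Nat.≟ 1)

  isPendant⇒Pendant : ∀ {v} → isPendant G v ≡ true → Pendant G v
  isPendant⇒Pendant {v} = does-true (degree G v Data.Nat.≟ 1)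

  pendantNbr⇒Adj : ∀ {v u} → pendantNbr v u ≡ true → Adj v u × Pendant G u
  pendantNbr⇒Adj {v} {u} h = let vu , pu = ∧-true (adj G v u) h in vu , isPendant⇒Pendant pu

  isPendant-false⇒¬Pendant : ∀ {v} → isPendant G v ≡ false → ¬ Pendant G v
  isPendant-false⇒¬Pendant ip pv with () ← trans (sym ip) (Pendant⇒isPendant pv)

  nonPendantNbr⇒Adj : ∀ {v u} → nonPendantNbr v u ≡ true → Adj v u × ¬ Pendant G u
  nonPendantNbr⇒Adj {v} {u} h with adj G v u | isPendant G u in ip
  ... | true  | false = refl , isPendant-false⇒¬Pendant ip
  ... | true  | true  with () ← h
  ... | false | _     with () ← h

  pendant-nbr-unique : ∀ {x s} → Pendant G x → Adj x s → ∀ {u} → Adj x u → u ≡ s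
  pendant-nbr-unique {x} px xs xu with countFin-one (adj G x) px
  ... | _ , _ , uniq = trans (uniq _ xu) (sym (uniq _ xs))

  unique-nbr⇒Pendant : ∀ {x s} → Adj x s → HoldsOnlyAt (adj G x) s → Pendant G x
  unique-nbr⇒Pendant {x} = countFin-unique (adj G x)

  pendantNbr-intro : ∀ {v u} → Adj v u → Pendant G u → pendantNbr v u ≡ true
  pendantNbr-intro vu pu = cong₂ _∧_ vu (Pendant⇒isPendant pu)

  nonPendantNbr-intro : ∀ {v u} → Adj v u → ¬ Pendant G u → nonPendantNbr v u ≡ true
  nonPendantNbr-intro vu npu = cong₂ _∧_ vu (cong not (¬Pendant⇒isPendant npu))

  two-nbrs⇒¬Pendant : ∀ {v s t} → Adj v s → Adj v t → t ≢ s → ¬ Pendant G v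
  two-nbrs⇒¬Pendant {v} vs vt t≢s pv with s≤s () ← subst (2 ≤_) pv (countFin-two (adj G v) vs vt t≢s)

module DiameterFour {n : ℕ} (T : Graph n) (tree : IsTree T) (diam : Diameter T 4)
                    (vc : Fin n) (central : IsCentral T vc) where
  open Walks T
  open Acyclic (proj₂ tree)
  open Leaves T

  noBacktrack-≤4 : ∀ {a b k} (w : Walk T a b k) → NoBacktrack w → k ≤ 4
  noBacktrack-≤4 {a} {b} w nb with proj₁ diam a b
  ... | _ , k≤4 , w′ = ≤-trans (noBacktrack-shortest w nb w′) k≤4

  -- A backtrack-free walk of length ≥ 3 out of x₂ starts away from x₁ or from x₃, so prefixing
  -- x₀ x₁ or x₄ x₃ to it gives a backtrack-free walk of length ≥ 5.
  middle-ecc≤2 : ∀ {x₀ x₁ x₂ x₃ x₄}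
    (e₁ : Adj x₀ x₁) (e₂ : Adj x₁ x₂) (e₃ : Adj x₂ x₃) (e₄ : Adj x₃ x₄) →
    NoBacktrack (cons e₁ (cons e₂ (cons e₃ (cons e₄ nil)))) → EccAtMost T x₂ 2
  middle-ecc≤2 {x₁ = x₁} {x₂} e₁ e₂ e₃ e₄ (x₀≢x₂ , x₁≢x₃ , x₂≢x₄ , _) z
    with removeBacktracks (proj₂ (proj₁ tree x₂ z))
  ... | _ , _ , nil , _                    = 0 , z≤n , nil
  ... | _ , _ , cons e nil , _             = 1 , s≤s z≤n , cons e nil
  ... | _ , _ , cons e (cons e′ nil) , _   = 2 , s≤s (s≤s z≤n) , cons e (cons e′ nil)
  ... | _ , _ , w@(cons {w = y} _ (cons _ (cons _ _))) , nb with x₁ ≟ y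
  ...   | no x₁≢y
        with s≤s (s≤s (s≤s (s≤s ()))) ← noBacktrack-≤4 (cons e₁ (cons e₂ w)) (x₀≢x₂ , x₁≢y , nb)
  ...   | yes refl
        with s≤s (s≤s (s≤s (s≤s ()))) ← noBacktrack-≤4 (cons (Adj-sym e₄) (cons (Adj-sym e₃) w))
                                                      (≢-sym x₂≢x₄ , ≢-sym x₁≢x₃ , nb)

  middle-of-long : ∀ {a b k} → 4 ≤ k → (w : Walk T a b k) → NoBacktrack w → ∃[ c ] EccAtMost T c 2
  middle-of-long () nil
  middle-of-long (s≤s ()) (cons _ nil)
  middle-of-long (s≤s (s≤s ())) (cons _ (cons _ nil))
  middle-of-long (s≤s (s≤s (s≤s ()))) (cons _ (cons _ (cons _ nil)))
  middle-of-long _ (cons e₁ (cons e₂ (cons e₃ (cons e₄ nil)))) nb = _ , middle-ecc≤2 e₁ e₂ e₃ e₄ nb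
  middle-of-long _ w@(cons _ (cons _ (cons _ (cons _ (cons _ _))))) nb
    with s≤s (s≤s (s≤s (s≤s ()))) ← noBacktrack-≤4 w nb

  vc-ecc≤2 : EccAtMost T vc 2
  vc-ecc≤2 with proj₂ diam
  ... | _ , _ , w , shortest with removeBacktracks w
  ... | j , _ , w′ , nb = let c , ecc = middle-of-long (shortest j w′) w′ nb in central c 2 ecc

  noBacktrack-from-vc-≤2 : ∀ {z k} (w : Walk T vc z k) → NoBacktrack w → k ≤ 2
  noBacktrack-from-vc-≤2 {z} w nb with vc-ecc≤2 z
  ... | _ , j≤2 , w′ = ≤-trans (noBacktrack-shortest w nb w′) j≤2

  AtDistanceTwo : Fin n → Set
  AtDistanceTwo z = ∃[ a ] (Adj vc a × Adj a z × z ≢ vc)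

  vertex-cases : ∀ z → z ≡ vc ⊎ Adj vc z ⊎ AtDistanceTwo z
  vertex-cases z with vc-ecc≤2 z
  ... | _ , _ , w with removeBacktracks w
  ... | _ , _ , nil , _                           = inj₁ refl
  ... | _ , _ , cons e nil , _                    = inj₂ (inj₁ e)
  ... | _ , _ , cons e (cons e′ nil) , (vc≢z , _) = inj₂ (inj₂ (_ , e , e′ , ≢-sym vc≢z))
  ... | _ , _ , w′@(cons _ (cons _ (cons _ _))) , nb
    with s≤s (s≤s ()) ← noBacktrack-from-vc-≤2 w′ nb

  distanceTwo⇒Pendant : ∀ {a x} → Adj vc a → Adj a x → x ≢ vc → Pendant T x
  distanceTwo⇒Pendant {a} {x} va ax x≢vc = unique-nbr⇒Pendant (Adj-sym ax) only-a
    where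
    only-a : HoldsOnlyAt (adj T x) a
    only-a y xy with y ≟ a
    ... | yes y≡a = y≡a
    ... | no y≢a
      with s≤s (s≤s ()) ← noBacktrack-from-vc-≤2 (cons va (cons ax (cons xy nil)))
                                                  (≢-sym x≢vc , ≢-sym y≢a , tt)

  module _ {y₀ y₄ : Fin n} (shortest : ∀ k → Walk T y₀ y₄ k → 4 ≤ k) where

    private
      tooShort : ∀ {k} → Walk T y₀ y₄ k → k ≤ 3 → ⊥
      tooShort w k≤3 with s≤s (s≤s (s≤s ())) ← ≤-trans (shortest _ w) k≤3

      branch-nonPendant : ∀ {a y} → Adj vc a → Adj a y → y ≢ vc → nonPendantNbr vc a ≡ true
      branch-nonPendant va ay y≢vc = nonPendantNbr-intro va (two-nbrs⇒¬Pendant (Adj-sym va) ay y≢vc)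

    diametral⇒nonPendantNbrs≥2 : 2 ≤ countFin (nonPendantNbr vc)
    diametral⇒nonPendantNbrs≥2 with vertex-cases y₀ | vertex-cases y₄ | vc-ecc≤2 y₄
    ... | inj₁ refl | _ | _ , k≤2 , w = ⊥-elim (tooShort w (≤-trans k≤2 (n≤1+n 2)))
    ... | inj₂ (inj₁ vy₀) | _ | _ , k≤2 , w = ⊥-elim (tooShort (cons (Adj-sym vy₀) w) (s≤s k≤2))
    ... | inj₂ (inj₂ (a₀ , va₀ , a₀y₀ , _)) | inj₁ refl | _ =
      ⊥-elim (tooShort (cons (Adj-sym a₀y₀) (cons (Adj-sym va₀) nil)) (s≤s (s≤s z≤n)))
    ... | inj₂ (inj₂ (a₀ , va₀ , a₀y₀ , _)) | inj₂ (inj₁ vy₄) | _ =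
      ⊥-elim (tooShort (cons (Adj-sym a₀y₀) (cons (Adj-sym va₀) (cons vy₄ nil))) (s≤s (s≤s (s≤s z≤n))))
    ... | inj₂ (inj₂ (a₀ , va₀ , a₀y₀ , y₀≢vc)) | inj₂ (inj₂ (a₄ , va₄ , a₄y₄ , y₄≢vc)) | _
      with a₄ ≟ a₀
    ...   | yes refl = ⊥-elim (tooShort (cons (Adj-sym a₀y₀) (cons a₄y₄ nil)) (s≤s (s≤s z≤n)))
    ...   | no a₄≢a₀ = countFin-two (nonPendantNbr vc)
                         (branch-nonPendant va₀ a₀y₀ y₀≢vc) (branch-nonPendant va₄ a₄y₄ y₄≢vc) a₄≢a₀

  vc-nonPendantNbrs≥2 : 2 ≤ countFin (nonPendantNbr vc)
  vc-nonPendantNbrs≥2 = let _ , _ , _ , shortest = proj₂ diam in diametral⇒nonPendantNbrs≥2 shortest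

  vc-¬Pendant : ¬ Pendant T vc
  vc-¬Pendant pv with s≤s () ← subst (2 ≤_) (trans (sym (degree-split vc)) pv)
                                  (≤-trans vc-nonPendantNbrs≥2 (m≤n+m _ (pendantNbrs T vc)))

  nonPendant⇒Adj-vc : ∀ {v} → ¬ Pendant T v → v ≢ vc → Adj vc v
  nonPendant⇒Adj-vc {v} npv v≢vc with vertex-cases v
  ... | inj₁ v≡vc                   = ⊥-elim (v≢vc v≡vc)
  ... | inj₂ (inj₁ vcv)             = vcv
  ... | inj₂ (inj₂ (_ , va , av , v≢vc′)) = ⊥-elim (npv (distanceTwo⇒Pendant va av v≢vc′))

  offCentre-nonPendantNbr-unique : ∀ {v} → ¬ Pendant T v → v ≢ vc → HoldsOnlyAt (nonPendantNbr v) vc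
  offCentre-nonPendantNbr-unique npv v≢vc u h with u ≟ vc | nonPendantNbr⇒Adj h
  ... | yes u≡vc | _        = u≡vc
  ... | no u≢vc  | vu , npu = ⊥-elim (npu (distanceTwo⇒Pendant (nonPendant⇒Adj-vc npv v≢vc) vu u≢vc))

  offCentre-nonPendantNbr-vc : ∀ {v} → ¬ Pendant T v → v ≢ vc → nonPendantNbr v vc ≡ true
  offCentre-nonPendantNbr-vc npv v≢vc = nonPendantNbr-intro (Adj-sym (nonPendant⇒Adj-vc npv v≢vc)) vc-¬Pendant

  offCentre-nonPendantNbrs≡1 : ∀ {v} → ¬ Pendant T v → v ≢ vc → countFin (nonPendantNbr v) ≡ 1
  offCentre-nonPendantNbrs≡1 {v} npv v≢vc =
    countFin-unique (nonPendantNbr v) (offCentre-nonPendantNbr-vc npv v≢vc)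
                                      (offCentre-nonPendantNbr-unique npv v≢vc)

  offCentre-support : ∀ {v} → ¬ Pendant T v → v ≢ vc → 1 ≤ pendantNbrs T v
  offCentre-support {v} npv v≢vc with pendantNbrs T v in #pendant
  ... | suc _ = s≤s z≤n
  ... | zero  =
    ⊥-elim (npv (trans (degree-split v) (cong₂ _+_ #pendant (offCentre-nonPendantNbrs≡1 npv v≢vc))))

  pendant-nbr-¬Pendant : ∀ {x s} → Pendant T x → Adj x s → ¬ Pendant T s
  pendant-nbr-¬Pendant {x} {s} px xs with s ≟ vc | vertex-cases x
  ... | yes refl | _                  = vc-¬Pendant
  ... | no s≢vc  | inj₁ refl          = ⊥-elim (vc-¬Pendant px)
  ... | no s≢vc  | inj₂ (inj₁ vcx)    = ⊥-elim (s≢vc (sym (pendant-nbr-unique px xs (Adj-sym vcx))))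
  ... | no s≢vc  | inj₂ (inj₂ (a , va , ax , x≢vc)) with pendant-nbr-unique px xs (Adj-sym ax)
  ...   | refl = two-nbrs⇒¬Pendant (Adj-sym va) ax x≢vc

module Labeling {c ℓ : Level} (Γ : AbelianGroup c ℓ) {n : ℕ} (G : Graph n) where
  open AbelianGroup Γ renaming (refl to ≈-refl; sym to ≈-sym; trans to ≈-trans)
  open Sums Γ
  open Walks G using (Adj; Adj-sym)
  open Leaves G
  open import Algebra.Properties.Group group using (x∙y⁻¹≈ε⇒x≈y; //-rightDividesˡ)

  support-label : ∀ {lab μ} → (∀ v → weight Γ G lab v ≈ μ) →
    ∀ {x s} → Pendant G x → Adj x s → lab s ≈ μ
  support-label {lab} magic {x} px xs =
    ≈-trans (≈-sym (sumOver-unique (adj G x) lab xs (λ u xu → pendant-nbr-unique px xs xu))) (magic x)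

  module Construction (torsionFree : TorsionFree Γ) (g : Carrier) (g≉ε : ¬ g ≈ ε)
    (pendant-nbr-¬Pendant : ∀ {x s} → Pendant G x → Adj x s → ¬ Pendant G s)
    (nonPendant-support : ∀ {s} → ¬ Pendant G s → 3 ≤ degree G s × ∃[ x ] pendantNbr s x ≡ true) where

    choose : (Fin n → Bool) → Fin n → Fin n
    choose p default with any? (λ u → p u Data.Bool.≟ true)
    ... | yes (u , _) = u
    ... | no _        = default

    choose-correct : ∀ (p : Fin n → Bool) {u} default → p u ≡ true → p (choose p default) ≡ true
    choose-correct p default pu with any? (λ u → p u Data.Bool.≟ true)
    ... | yes (_ , pv) = pv
    ... | no none      = ⊥-elim (none (_ , pu))

    parent leaf : Fin n → Fin n
    parent x = choose (adj G x) x
    leaf   s = choose (pendantNbr s) s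

    compensation : Fin n → Carrier
    compensation s = g ∙ times Γ (countFin (adj G s without leaf s)) g ⁻¹

    label : Fin n → Carrier
    label x = if isPendant G x ∧ does (x ≟ leaf (parent x)) then compensation (parent x) else g

    pendant-Adj-parent : ∀ {x} → Pendant G x → Adj x (parent x)
    pendant-Adj-parent {x} px =
      choose-correct (adj G x) x (proj₂ (countFin-witness (adj G x) (≤-reflexive (sym px))))

    parent-unique : ∀ {x s} → Pendant G x → Adj x s → parent x ≡ s
    parent-unique px xs = pendant-nbr-unique px xs (pendant-Adj-parent px)

    leaf-pendantNbr : ∀ {s} → ¬ Pendant G s → pendantNbr s (leaf s) ≡ true
    leaf-pendantNbr {s} nps = choose-correct (pendantNbr s) s (proj₂ (proj₂ (nonPendant-support nps)))

    label-¬Pendant : ∀ {x} → ¬ Pendant G x → label x ≡ g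
    label-¬Pendant npx rewrite ¬Pendant⇒isPendant npx = refl

    label-leaf : ∀ {s} → ¬ Pendant G s → label (leaf s) ≡ compensation s
    label-leaf {s} nps with pendantNbr⇒Adj (leaf-pendantNbr nps)
    ... | s-leaf , p-leaf
      rewrite Pendant⇒isPendant p-leaf | parent-unique p-leaf (Adj-sym s-leaf)
            | dec-true (leaf s ≟ leaf s) refl = refl

    label-other : ∀ {s u} → (adj G s without leaf s) u ≡ true → label u ≡ g
    label-other {s} {u} h with without-true (adj G s) h | isPendant G u in ip
    ... | _    , _         | false = refl
    ... | s-u , u≢leaf | true
      rewrite parent-unique (isPendant⇒Pendant ip) (Adj-sym s-u) | dec-false (u ≟ leaf s) u≢leaf = refl

    leaf-Adj : ∀ {s} → ¬ Pendant G s → Adj s (leaf s)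
    leaf-Adj nps = proj₁ (pendantNbr⇒Adj (leaf-pendantNbr nps))

    others≥2 : ∀ {s} → ¬ Pendant G s → 2 ≤ countFin (adj G s without leaf s)
    others≥2 {s} nps =
      s≤s⁻¹ (subst (3 ≤_) (countFin-remove (adj G s) (leaf-Adj nps)) (proj₁ (nonPendant-support nps)))

    compensation≉ε : ∀ {s} → ¬ Pendant G s → ¬ compensation s ≈ ε
    compensation≉ε {s} nps comp≈ε =
      g≉ε (times-fixed⇒≈ε torsionFree (others≥2 nps) (≈-sym (x∙y⁻¹≈ε⇒x≈y g _ comp≈ε)))

    label≉ε : ∀ x → ¬ label x ≈ ε
    label≉ε x with isPendant G x in ip | does (x ≟ leaf (parent x))
    ... | true  | true  = let px = isPendant⇒Pendant ip in
                          compensation≉ε (pendant-nbr-¬Pendant px (pendant-Adj-parent px))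
    ... | true  | false = g≉ε
    ... | false | _     = g≉ε

    weight-Pendant : ∀ {x} → Pendant G x → weight Γ G label x ≈ g
    weight-Pendant {x} px = ≈-trans (sumOver-unique (adj G x) label x-p (λ u → pendant-nbr-unique px x-p))
                                    (reflexive (label-¬Pendant (pendant-nbr-¬Pendant px x-p)))
      where x-p = pendant-Adj-parent px

    weight-¬Pendant : ∀ {s} → ¬ Pendant G s → weight Γ G label s ≈ g
    weight-¬Pendant {s} nps = begin
      weight Γ G label s
        ≈⟨ sumOver-remove (adj G s) label (leaf-Adj nps) ⟩
      label (leaf s) ∙ sumOver (adj G s without leaf s) label
        ≈⟨ ∙-cong (reflexive (label-leaf nps)) (sumOver-const _ label (λ u → reflexive ∘ label-other)) ⟩
      compensation s ∙ times Γ (countFin (adj G s without leaf s)) g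
        ≈⟨ //-rightDividesˡ _ g ⟩
      g ∎
      where open import Relation.Binary.Reasoning.Setoid setoid

    vertexMagic : VertexMagic Γ G
    vertexMagic = label , label≉ε , g , weight≈g
      where
      weight≈g : ∀ v → weight Γ G label v ≈ g
      weight≈g v with degree G v Data.Nat.≟ 1
      ... | yes pv = weight-Pendant pv
      ... | no npv = weight-¬Pendant npv

module DiameterFourMagic {c ℓ : Level} (Γ : AbelianGroup c ℓ) (torsionFree : TorsionFree Γ)
  {n : ℕ} (T : Graph n) (tree : IsTree T) (diam : Diameter T 4) (vc : Fin n) (central : IsCentral T vc) where
  open AbelianGroup Γ renaming (refl to ≈-refl; sym to ≈-sym; trans to ≈-trans)
  open import Algebra.Properties.Group group using (loop)
  open import Algebra.Properties.Loop loop using (identityˡ-unique)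
  open Sums Γ
  open Walks T using (Adj; Adj-sym; Adj-irrefl)
  open Leaves T
  open DiameterFour T tree diam vc central
  open Labeling Γ T

  AllStrong CentreWeak : Set
  AllStrong  = ∀ v → ¬ Pendant T v → StrongSupport T v
  CentreWeak = WeakSupport T vc × (∀ v → ¬ Pendant T v → v ≢ vc → StrongSupport T v)

  module Necessity (lab : Fin n → Carrier) (lab≉ε : ∀ v → ¬ lab v ≈ ε)
                   (μ : Carrier) (magic : ∀ v → weight Γ T lab v ≈ μ) where

    centre-support : 1 ≤ pendantNbrs T vc
    centre-support with pendantNbrs T vc in #pendant
    ... | suc _ = s≤s z≤n
    ... | zero  = let a , va = countFin-witness (adj T vc) (≤-trans (s≤s z≤n) degree≥2) in
                  ⊥-elim (lab≉ε a (≈-trans (nbr-label va) μ≈ε))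
      where
      nbr-label : ∀ {a} → Adj vc a → lab a ≈ μ
      nbr-label {a} va with countFin-witness (pendantNbr a) (offCentre-support npa a≢vc)
        where
        npa : ¬ Pendant T a
        npa pa with () ← trans (sym (pendantNbr-intro va pa)) (countFin-zero (pendantNbr vc) #pendant a)
        a≢vc : a ≢ vc
        a≢vc refl = Adj-irrefl va
      ... | x , ax with pendantNbr⇒Adj ax
      ... | a-x , px = support-label magic px (Adj-sym a-x)

      degree≥2 : 2 ≤ degree T vc
      degree≥2 = subst (2 ≤_) (sym (trans (degree-split vc) (cong (_+ countFin (nonPendantNbr vc)) #pendant)))
                             vc-nonPendantNbrs≥2

      μ≈ε : μ ≈ ε
      μ≈ε = times-fixed⇒≈ε torsionFree degree≥2
              (≈-trans (≈-sym (sumOver-const (adj T vc) lab (λ _ → nbr-label))) (magic vc))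

    centre-label : lab vc ≈ μ
    centre-label with countFin-witness (pendantNbr vc) centre-support
    ... | x , vc-x with pendantNbr⇒Adj vc-x
    ... | vcx , px = support-label magic px (Adj-sym vcx)

    offCentre-strong : ∀ v → ¬ Pendant T v → v ≢ vc → StrongSupport T v
    offCentre-strong v npv v≢vc with pendantNbrs T v in #pendant | offCentre-support npv v≢vc
    ... | suc (suc _) | _ = s≤s (s≤s z≤n)
    ... | 1           | _ with countFin-one (pendantNbr v) #pendant
    ... | x , v-x , only-x = ⊥-elim (lab≉ε x (identityˡ-unique (lab x) μ (begin
      lab x ∙ μ
        ≈⟨ ∙-cong pendant-sum nonPendant-sum ⟨
      sumOver (pendantNbr v) lab ∙ sumOver (nonPendantNbr v) lab
        ≈⟨ sumOver-split (adj T v) (isPendant T) lab ⟨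
      weight Γ T lab v
        ≈⟨ magic v ⟩
      μ ∎)))
      where
      open import Relation.Binary.Reasoning.Setoid setoid
      pendant-sum : sumOver (pendantNbr v) lab ≈ lab x
      pendant-sum = sumOver-unique (pendantNbr v) lab v-x only-x
      nonPendant-sum : sumOver (nonPendantNbr v) lab ≈ μ
      nonPendant-sum = ≈-trans (sumOver-unique (nonPendantNbr v) lab (offCentre-nonPendantNbr-vc npv v≢vc)
                                               (offCentre-nonPendantNbr-unique npv v≢vc))
                               centre-label

    conditions : AllStrong ⊎ CentreWeak
    conditions with pendantNbrs T vc in #pendant | centre-support
    ... | 1           | _ = inj₂ (refl , offCentre-strong)
    ... | suc (suc _) | _ = inj₁ all-strong
      where
      all-strong : AllStrong
      all-strong v npv with v ≟ vc
      ... | yes refl = subst (2 ≤_) (sym #pendant) (s≤s (s≤s z≤n))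
      ... | no v≢vc  = offCentre-strong v npv v≢vc

  module Sufficiency (infinite : Infinite Γ) (centre-support : 1 ≤ pendantNbrs T vc)
                     (offCentre-strong : ∀ v → ¬ Pendant T v → v ≢ vc → StrongSupport T v) where

    degree-≥ : ∀ {s a b} → a ≤ pendantNbrs T s → b ≤ countFin (nonPendantNbr s) → a + b ≤ degree T s
    degree-≥ {s} a≤ b≤ = subst (_ ≤_) (sym (degree-split s)) (+-mono-≤ a≤ b≤)

    nonPendant-support : ∀ {s} → ¬ Pendant T s → 3 ≤ degree T s × ∃[ x ] pendantNbr s x ≡ true
    nonPendant-support {s} nps with s ≟ vc
    ... | yes refl = degree-≥ centre-support vc-nonPendantNbrs≥2 , countFin-witness _ centre-support
    ... | no s≢vc  =
      degree-≥ (offCentre-strong s nps s≢vc) (≤-reflexive (sym (offCentre-nonPendantNbrs≡1 nps s≢vc))) ,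
      countFin-witness _ (offCentre-support nps s≢vc)

    vertexMagic : VertexMagic Γ T
    vertexMagic with infinite 1 (λ _ → ε)
    ... | g , g≢ε = Construction.vertexMagic torsionFree g (g≢ε zero) pendant-nbr-¬Pendant nonPendant-support

theorem4p2 : ∀ {c ℓ : Level} (Γ : AbelianGroup c ℓ) → Infinite Γ → TorsionFree Γ →
    (n : ℕ) (T : Graph n) → IsTree T → Diameter T 4 →
    (vc : Fin n) → IsCentral T vc →
    (VertexMagic Γ T ⇔
      ((∀ v → ¬ Pendant T v → StrongSupport T v)
       ⊎ (WeakSupport T vc × (∀ v → ¬ Pendant T v → v ≢ vc → StrongSupport T v))))
theorem4p2 Γ infinite torsionFree n T tree diam vc central = mk⇔ necessity sufficiency
  where
  open DiameterFourMagic Γ torsionFree T tree diam vc central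
  open DiameterFour T tree diam vc central using (vc-¬Pendant)

  necessity : VertexMagic Γ T → AllStrong ⊎ CentreWeak
  necessity (lab , lab≉ε , μ , magic) = Necessity.conditions lab lab≉ε μ magic

  sufficiency : AllStrong ⊎ CentreWeak → VertexMagic Γ T
  sufficiency (inj₁ all-strong)           =
    Sufficiency.vertexMagic infinite (≤-trans (s≤s z≤n) (all-strong vc vc-¬Pendant))
                                     (λ v npv _ → all-strong v npv)
  sufficiency (inj₂ (centre-weak , strong)) =
    Sufficiency.vertexMagic infinite (≤-reflexive (sym centre-weak)) strong
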